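{- Let $2k+1$ be a prime and let $G$ and $H$ be finite simple graphs. If both $G$ and $H$ admit a $(2k+1)$-neighborhood balanced coloring, then the lexicographic product $G[H]$ admits a $(2k+1)$-neighborhood balanced coloring.
   Context: For a prime $2k+1$ (with $k\ge 1$), a $(2k+1)$-neighborhood balanced coloring of a finite simple graph is an assignment to each vertex of one of $2k+1$ colors $R_1,\dots,R_{2k+1}$ such that every vertex has an equal number of neighbors of each color. The lexicographic product $G[H]$ has vertex set $V(G)\times V(H)$, with $(u,v)$ and $(u',v')$ adjacent if and only if either $uu'\in E(G)$, or $u=u'$ and $vv'\in E(H)$. -}

module Defs where

open import Data.Nat using (ℕ; zero; suc; _+_; _*_)
open import Data.Bool using (Bool; true; false; _∧_; _∨_; if_then_else_)
open import Data.Fin using (Fin; _≟_; remQuot)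
import Data.Fin as F
open import Data.Product using (Σ; _×_; _,_)
open import Relation.Binary.PropositionalEquality using (_≡_)
open import Relation.Nullary.Decidable using (⌊_⌋)

record Graph : Set where
  field
    n     : ℕ
    adj   : Fin n → Fin n → Bool
    sym   : ∀ u v → adj u v ≡ adj v u
    irr   : ∀ v → adj v v ≡ false
open Graph public

_==_ : ∀ {m} → Fin m → Fin m → Bool
i == j = ⌊ i ≟ j ⌋

countTrue : (m : ℕ) → (Fin m → Bool) → ℕ
countTrue zero    p = 0
countTrue (suc m) p = (if p F.zero then 1 else 0) + countTrue m (λ i → p (F.suc i))

nbrCount : {m r : ℕ} → (Fin m → Fin m → Bool) → (Fin m → Fin r) → Fin m → Fin r → ℕ
nbrCount {m} a col v c = countTrue m (λ w → a v w ∧ (col w == c))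

IsNBColoring : {m : ℕ} (a : Fin m → Fin m → Bool) (r : ℕ) → (Fin m → Fin r) → Set
IsNBColoring a r col = ∀ v c c' → nbrCount a col v c ≡ nbrCount a col v c'

HasNBColoring : {m : ℕ} (a : Fin m → Fin m → Bool) (r : ℕ) → Set
HasNBColoring {m} a r = Σ (Fin m → Fin r) (IsNBColoring a r)

-- Lexicographic product G[H] on vertex set Fin (n G * n H) ≅ Fin (n G) × Fin (n H)
-- (via remQuot, a bijection): (u,v) ~ (u',v') iff u u' ∈ E(G), or u = u' and v v' ∈ E(H).
lexAdj : (G H : Graph) → Fin (n G * n H) → Fin (n G * n H) → Bool
lexAdj G H x y with remQuot {n G} (n H) x | remQuot {n G} (n H) y
... | (u , v) | (u' , v') = adj G u u' ∨ ((u == u') ∧ adj H v v')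

module Submission where

-- Colour the vertex (u , v) of G[H] by cG u + cH v in ℤ/r.  The neighbours of (u , v) are the
-- (u' , v') with u' ~ u and v' arbitrary, together with the (u , v') with v' ~ v; the two kinds
-- are disjoint because G has no loops.  For each fixed v', the neighbours u' of u with
-- cG u' + cH v' = c are those coloured c - cH v', whose number does not depend on c since cG is
-- balanced; likewise the second kind are the neighbours of v coloured c - cG u.  So only r ≠ 0
-- is used, not primality.

open import Defs
open import Data.Nat using (ℕ; suc; _+_; _*_; _≤_; _∸_; NonZero)
open import Data.Nat.Primality using (Prime; prime⇒nonZero)

import Data.Nat as ℕ
open import Data.Nat.Properties using (+-*-semiring; +-assoc; +-comm; +-identityʳ; <⇒≤; m+[n∸m]≡n; m∸n+n≡m)
open import Algebra.Properties.Semiring.Sum +-*-semiring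
  using (sum; sum-syntax; sum-cong-≗; sum-replicate-zero; ∑-comm; ∑-distrib-+; *-distribˡ-sum)
open import Data.Bool using (Bool; true; false; _∧_; _∨_; if_then_else_)
open import Data.Fin using (Fin; zero; suc; toℕ; fromℕ<; _↑ˡ_; _↑ʳ_; combine; remQuot; _≟_)
open import Data.Fin.Properties using (toℕ-fromℕ<; toℕ-injective; toℕ<n; suc-injective; remQuot-combine; combine-remQuot)
open import Data.Nat.DivMod using (_%_; m%n<n; %-distribˡ-+; m%n%n≡m%n; [m+n]%n≡m%n; m<n⇒m%n≡m)
open import Data.Product using (_×_; _,_; proj₁; proj₂)
open import Function.Bundles using (_⇔_; mk⇔)
open import Relation.Binary.PropositionalEquality as ≡ using (_≡_; refl; cong; cong₂; module ≡-Reasoning)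
open import Relation.Nullary using (yes; no; contradiction)
open import Relation.Nullary.Decidable using (does-⇔; isYes≗does)
open ≡-Reasoning

𝟙 : Bool → ℕ
𝟙 b = if b then 1 else 0

𝟙-∨-∧ : ∀ a e h c → (a ≡ true → e ≡ false) → 𝟙 ((a ∨ (e ∧ h)) ∧ c) ≡ 𝟙 (a ∧ c) + 𝟙 e * 𝟙 (h ∧ c)
𝟙-∨-∧ true  e     h c a⇒¬e rewrite a⇒¬e refl = ≡.sym (+-identityʳ (𝟙 c))
𝟙-∨-∧ false true  h c _ = ≡.sym (+-identityʳ (𝟙 (h ∧ c)))
𝟙-∨-∧ false false h c _ = refl

countTrue≡∑𝟙 : ∀ m (p : Fin m → Bool) → countTrue m p ≡ ∑[ i < m ] 𝟙 (p i)
countTrue≡∑𝟙 ℕ.zero    p = refl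
countTrue≡∑𝟙 (ℕ.suc m) p = cong (𝟙 (p zero) +_) (countTrue≡∑𝟙 m (λ i → p (suc i)))

==-cong-⇔ : ∀ {m n} {i j : Fin m} {k l : Fin n} → i ≡ j ⇔ k ≡ l → (i == j) ≡ (k == l)
==-cong-⇔ {i = i} {j} {k} {l} i≡j⇔k≡l =
  ≡.trans (isYes≗does (i ≟ j)) (≡.trans (does-⇔ i≡j⇔k≡l (i ≟ j) (k ≟ l)) (≡.sym (isYes≗does (k ≟ l))))

∑-↑ : ∀ a {b} (f : Fin (a + b) → ℕ) → sum f ≡ ∑[ i < a ] f (i ↑ˡ b) + ∑[ j < b ] f (a ↑ʳ j)
∑-↑ ℕ.zero    f = refl
∑-↑ (ℕ.suc a) f = ≡.trans (cong (f zero +_) (∑-↑ a (λ i → f (suc i)))) (≡.sym (+-assoc (f zero) _ _))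

∑-combine : ∀ m {n} (f : Fin (m * n) → ℕ) → sum f ≡ ∑[ i < m ] ∑[ j < n ] f (combine i j)
∑-combine ℕ.zero        f = refl
∑-combine (ℕ.suc m) {n} f = ≡.trans (∑-↑ n f) (cong (sum (λ j → f (j ↑ˡ (m * n))) +_) (∑-combine m (λ k → f (n ↑ʳ k))))

∑-𝟙==-* : ∀ {m} (i : Fin m) (f : Fin m → ℕ) → ∑[ j < m ] (𝟙 (i == j) * f j) ≡ f i
∑-𝟙==-* {ℕ.suc m} zero f = begin
  f zero + 0 + ∑[ j < m ] 0  ≡⟨ cong (f zero + 0 +_) (sum-replicate-zero m) ⟩
  f zero + 0 + 0             ≡⟨ +-identityʳ _ ⟩
  f zero + 0                 ≡⟨ +-identityʳ _ ⟩
  f zero                     ∎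
∑-𝟙==-* {ℕ.suc m} (suc i) f = begin
  ∑[ j < m ] (𝟙 (suc i == suc j) * f (suc j))
    ≡⟨ sum-cong-≗ (λ j → cong (λ e → 𝟙 e * f (suc j)) (==-cong-⇔ {i = suc i} {suc j} {i} {j} (mk⇔ suc-injective (cong suc)))) ⟩
  ∑[ j < m ] (𝟙 (i == j) * f (suc j))
    ≡⟨ ∑-𝟙==-* i (λ j → f (suc j)) ⟩
  f (suc i)                                  ∎

module CyclicGroup (r : ℕ) .{{_ : NonZero r}} where

  [m%d+n]%d≡[m+n]%d : ∀ m n → (m % r + n) % r ≡ (m + n) % r
  [m%d+n]%d≡[m+n]%d m n = begin
    (m % r + n) % r           ≡⟨ %-distribˡ-+ (m % r) n r ⟩
    (m % r % r + n % r) % r   ≡⟨ cong (λ z → (z + n % r) % r) (m%n%n≡m%n m r) ⟩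
    (m % r + n % r) % r       ≡⟨ %-distribˡ-+ m n r ⟨
    (m + n) % r               ∎

  infixl 21 _⊕_ _⊖_

  _⊕_ : Fin r → Fin r → Fin r
  a ⊕ b = fromℕ< (m%n<n (toℕ a + toℕ b) r)

  _⊖_ : Fin r → Fin r → Fin r
  -- r ∸ toℕ b represents - b without truncation, as toℕ b < r.
  c ⊖ b = fromℕ< (m%n<n (toℕ c + (r ∸ toℕ b)) r)

  ⊕-comm : ∀ a b → a ⊕ b ≡ b ⊕ a
  ⊕-comm a b = toℕ-injective (begin
    toℕ (a ⊕ b)          ≡⟨ toℕ-fromℕ< _ ⟩
    (toℕ a + toℕ b) % r  ≡⟨ cong (_% r) (+-comm (toℕ a) (toℕ b)) ⟩
    (toℕ b + toℕ a) % r  ≡⟨ toℕ-fromℕ< _ ⟨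
    toℕ (b ⊕ a)          ∎)

  ⊕-⊖-cancel : ∀ a b → (a ⊕ b) ⊖ b ≡ a
  ⊕-⊖-cancel a b = toℕ-injective (begin
    toℕ ((a ⊕ b) ⊖ b)                   ≡⟨ toℕ-fromℕ< _ ⟩
    (toℕ (a ⊕ b) + (r ∸ B)) % r         ≡⟨ cong (λ z → (z + (r ∸ B)) % r) (toℕ-fromℕ< _) ⟩
    ((A + B) % r + (r ∸ B)) % r         ≡⟨ [m%d+n]%d≡[m+n]%d (A + B) (r ∸ B) ⟩
    (A + B + (r ∸ B)) % r               ≡⟨ cong (_% r) (+-assoc A B (r ∸ B)) ⟩
    (A + (B + (r ∸ B))) % r             ≡⟨ cong (λ z → (A + z) % r) (m+[n∸m]≡n (<⇒≤ (toℕ<n b))) ⟩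
    (A + r) % r                         ≡⟨ [m+n]%n≡m%n A r ⟩
    A % r                               ≡⟨ m<n⇒m%n≡m (toℕ<n a) ⟩
    A                                   ∎)
    where A = toℕ a ; B = toℕ b

  ⊖-⊕-cancel : ∀ c b → (c ⊖ b) ⊕ b ≡ c
  ⊖-⊕-cancel c b = toℕ-injective (begin
    toℕ ((c ⊖ b) ⊕ b)                   ≡⟨ toℕ-fromℕ< _ ⟩
    (toℕ (c ⊖ b) + B) % r               ≡⟨ cong (λ z → (z + B) % r) (toℕ-fromℕ< _) ⟩
    ((C + (r ∸ B)) % r + B) % r         ≡⟨ [m%d+n]%d≡[m+n]%d (C + (r ∸ B)) B ⟩
    (C + (r ∸ B) + B) % r               ≡⟨ cong (_% r) (+-assoc C (r ∸ B) B) ⟩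
    (C + (r ∸ B + B)) % r               ≡⟨ cong (λ z → (C + z) % r) (m∸n+n≡m (<⇒≤ (toℕ<n b))) ⟩
    (C + r) % r                         ≡⟨ [m+n]%n≡m%n C r ⟩
    C % r                               ≡⟨ m<n⇒m%n≡m (toℕ<n c) ⟩
    C                                   ∎)
    where B = toℕ b ; C = toℕ c

  ⊕≡⇔≡⊖ : ∀ {a b c} → a ⊕ b ≡ c ⇔ a ≡ c ⊖ b
  ⊕≡⇔≡⊖ {a} {b} = mk⇔ (λ { refl → ≡.sym (⊕-⊖-cancel a b) }) (λ { refl → ⊖-⊕-cancel _ b })

  ⊕==≡==⊖ : ∀ a b c → (a ⊕ b == c) ≡ (a == c ⊖ b)
  ⊕==≡==⊖ a b c = ==-cong-⇔ ⊕≡⇔≡⊖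

  ∑-shift≡nbrCount : ∀ {m} (a : Fin m → Fin m → Bool) (col : Fin m → Fin r) v b c →
    ∑[ w < m ] 𝟙 (a v w ∧ (col w ⊕ b == c)) ≡ nbrCount a col v (c ⊖ b)
  ∑-shift≡nbrCount {m} a col v b c = ≡.trans
    (sum-cong-≗ (λ w → cong (λ e → 𝟙 (a v w ∧ e)) (⊕==≡==⊖ (col w) b c)))
    (≡.sym (countTrue≡∑𝟙 m _))

adj⇒≢ : (G : Graph) {u u' : Fin (n G)} → adj G u u' ≡ true → (u == u') ≡ false
adj⇒≢ G {u} {u'} uu' with u ≟ u'
... | no _     = refl
... | yes refl = contradiction (≡.trans (≡.sym uu') (irr G u)) λ ()

lexAdj-combine : ∀ G H u v u' v' →
  lexAdj G H (combine u v) (combine u' v') ≡ adj G u u' ∨ ((u == u') ∧ adj H v v')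
lexAdj-combine G H u v u' v' =
  cong₂ lexAdjᵖ (remQuot-combine u v) (remQuot-combine u' v')
  where
  lexAdjᵖ : Fin (n G) × Fin (n H) → Fin (n G) × Fin (n H) → Bool
  lexAdjᵖ (u , v) (u' , v') = adj G u u' ∨ ((u == u') ∧ adj H v v')

module LexColouring {r} .{{_ : NonZero r}} (G H : Graph) (cG : Fin (n G) → Fin r) (cH : Fin (n H) → Fin r) where
  open CyclicGroup r

  colour : Fin (n G * n H) → Fin r
  colour x = cG (proj₁ (remQuot {n G} (n H) x)) ⊕ cH (proj₂ (remQuot {n G} (n H) x))

  colour-combine : ∀ u v → colour (combine u v) ≡ cG u ⊕ cH v
  colour-combine u v = cong (λ p → cG (proj₁ p) ⊕ cH (proj₂ p)) (remQuot-combine u v)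

  nbrCount-combine : ∀ u v c → nbrCount (lexAdj G H) colour (combine u v) c ≡
    ∑[ v' < n H ] nbrCount (adj G) cG u (c ⊖ cH v') + nbrCount (adj H) cH v (c ⊖ cG u)
  nbrCount-combine u v c = begin
    nbrCount (lexAdj G H) colour (combine u v) c
      ≡⟨ countTrue≡∑𝟙 (n G * n H) _ ⟩
    sum (λ y → 𝟙 (lexAdj G H (combine u v) y ∧ (colour y == c)))
      ≡⟨ ∑-combine (n G) _ ⟩
    ∑[ u' < n G ] ∑[ v' < n H ] 𝟙 (lexAdj G H (combine u v) (combine u' v') ∧ (colour (combine u' v') == c))
      ≡⟨ sum-cong-≗ (λ u' → sum-cong-≗ (λ v' → split u' v')) ⟩
    ∑[ u' < n G ] ∑[ v' < n H ] (Gterm u' v' + 𝟙 (u == u') * Hterm u' v')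
      ≡⟨ sum-cong-≗ (λ u' → ∑-distrib-+ (Gterm u') (λ v' → 𝟙 (u == u') * Hterm u' v')) ⟩
    ∑[ u' < n G ] (∑[ v' < n H ] Gterm u' v' + ∑[ v' < n H ] (𝟙 (u == u') * Hterm u' v'))
      ≡⟨ ∑-distrib-+ (λ u' → sum (Gterm u')) (λ u' → ∑[ v' < n H ] (𝟙 (u == u') * Hterm u' v')) ⟩
    ∑[ u' < n G ] ∑[ v' < n H ] Gterm u' v' + ∑[ u' < n G ] ∑[ v' < n H ] (𝟙 (u == u') * Hterm u' v')
      ≡⟨ cong₂ _+_ (∑-comm Gterm) (sum-cong-≗ (λ u' → ≡.sym (*-distribˡ-sum (𝟙 (u == u')) (Hterm u')))) ⟩
    ∑[ v' < n H ] ∑[ u' < n G ] Gterm u' v' + ∑[ u' < n G ] (𝟙 (u == u') * ∑[ v' < n H ] Hterm u' v')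
      ≡⟨ cong₂ _+_ (sum-cong-≗ (λ v' → ∑-shift≡nbrCount (adj G) cG u (cH v') c))
                   (∑-𝟙==-* u (λ u' → sum (Hterm u'))) ⟩
    ∑[ v' < n H ] nbrCount (adj G) cG u (c ⊖ cH v') + ∑[ v' < n H ] Hterm u v'
      ≡⟨ cong (_ +_) (≡.trans (sum-cong-≗ (λ v' → cong (λ w → 𝟙 (adj H v v' ∧ (w == c))) (⊕-comm (cG u) (cH v'))))
                               (∑-shift≡nbrCount (adj H) cH v (cG u) c)) ⟩
    ∑[ v' < n H ] nbrCount (adj G) cG u (c ⊖ cH v') + nbrCount (adj H) cH v (c ⊖ cG u)
      ∎
    where
    Gterm : Fin (n G) → Fin (n H) → ℕ
    Gterm u' v' = 𝟙 (adj G u u' ∧ (cG u' ⊕ cH v' == c))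
    Hterm : Fin (n G) → Fin (n H) → ℕ
    Hterm u' v' = 𝟙 (adj H v v' ∧ (cG u' ⊕ cH v' == c))
    split : ∀ u' v' → 𝟙 (lexAdj G H (combine u v) (combine u' v') ∧ (colour (combine u' v') == c))
                      ≡ Gterm u' v' + 𝟙 (u == u') * Hterm u' v'
    split u' v' rewrite lexAdj-combine G H u v u' v' | colour-combine u' v' =
      𝟙-∨-∧ (adj G u u') (u == u') (adj H v v') (cG u' ⊕ cH v' == c) (adj⇒≢ G)

  colour-balanced : IsNBColoring (adj G) r cG → IsNBColoring (adj H) r cH → IsNBColoring (lexAdj G H) r colour
  colour-balanced balG balH x c c' =
    ≡.subst (λ y → nbrCount (lexAdj G H) colour y c ≡ nbrCount (lexAdj G H) colour y c')
            (combine-remQuot {n G} (n H) x)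
            (balanced-at (proj₁ (remQuot {n G} (n H) x)) (proj₂ (remQuot {n G} (n H) x)))
    where
    balanced-at : ∀ u v → nbrCount (lexAdj G H) colour (combine u v) c ≡ nbrCount (lexAdj G H) colour (combine u v) c'
    balanced-at u v = begin
      nbrCount (lexAdj G H) colour (combine u v) c
        ≡⟨ nbrCount-combine u v c ⟩
      ∑[ v' < n H ] nbrCount (adj G) cG u (c ⊖ cH v') + nbrCount (adj H) cH v (c ⊖ cG u)
        ≡⟨ cong₂ _+_ (sum-cong-≗ (λ v' → balG u (c ⊖ cH v') (c' ⊖ cH v'))) (balH v (c ⊖ cG u) (c' ⊖ cG u)) ⟩
      ∑[ v' < n H ] nbrCount (adj G) cG u (c' ⊖ cH v') + nbrCount (adj H) cH v (c' ⊖ cG u)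
        ≡⟨ nbrCount-combine u v c' ⟨
      nbrCount (lexAdj G H) colour (combine u v) c'
        ∎

lexAdj-hasNBColoring : ∀ {r} .{{_ : NonZero r}} (G H : Graph) →
  HasNBColoring (adj G) r → HasNBColoring (adj H) r → HasNBColoring (lexAdj G H) r
lexAdj-hasNBColoring G H (cG , balG) (cH , balH) = colour , colour-balanced balG balH
  where open LexColouring G H cG cH

theorem2p7 : (k : ℕ) → 1 ≤ k → Prime (2 * k + 1) → (G H : Graph) →
    HasNBColoring (adj G) (2 * k + 1) → HasNBColoring (adj H) (2 * k + 1) →
    HasNBColoring (lexAdj G H) (2 * k + 1)
theorem2p7 k _ p = lexAdj-hasNBColoring {{prime⇒nonZero p}}
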